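{- For each $k,t,r \in \mathbb{N}$ with $3 \le t \le k$, we have $$\binom{rk-t}{k,\dots,k,k-t} \le e^{ -(r-1)t^2/3rk} r^{rk-t},$$ where the multinomial coefficient has $r-1$ entries equal to $k$ and one entry equal to $k-t$. -}

module Defs where

open import Data.Nat as ℕ using (ℕ; zero; suc; _+_; _*_; _∸_; _!)
open import Data.Nat.Combinatorics using (_C_)
open import Data.List using (List; []; _∷_)
open import Data.Nat.ListAction using (sum)
open import Data.Integer using (+_)
open import Data.Rational as ℚ using (ℚ)

multinomial : List ℕ → ℕ
multinomial []       = 1
multinomial (a ∷ as) = ((a + sum as) C a) * multinomial as

-- The rational number a / b (with the harmless convention a / 0 := 0;
-- it is only used with b ≥ 1).
ratio : ℕ → ℕ → ℚ
ratio a zero    = ℚ.0ℚ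
ratio a (suc b) = (+ a) ℚ./ suc b

_^ℚ_ : ℚ → ℕ → ℚ
x ^ℚ zero  = ℚ.1ℚ
x ^ℚ suc n = x ℚ.* (x ^ℚ n)

-- Partial sums of the exponential series:  expPartial N x = Σ_{j=0}^{N} x^j / j!.
-- For x ≥ 0 these increase to e^x, so e^x = sup_N expPartial N x.
expPartial : ℕ → ℚ → ℚ
expPartial zero    x = ℚ.1ℚ
expPartial (suc N) x = expPartial N x ℚ.+ ((x ^ℚ suc N) ℚ.* ratio 1 (suc N !))

ℕtoℚ : ℕ → ℚ
ℕtoℚ n = (+ n) ℚ./ 1

{-# OPTIONS --safe #-}
module Submission where

-- Write r = 1 + j and let M d be the multinomial coefficient with j parts k and one part d.  Since
-- t² ≤ 3 (0 + 1 + ⋯ + (t − 1)) for t ≥ 3, it suffices to show, by induction on t, that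
--   M d · E (j (0 + 1 + ⋯ + (t − 1)) / rk) ≤ r ^ (jk + d)   whenever t + d = k,
-- where E is the partial exponential sum.  For t = 0 this is the bound M ≤ (number of parts) ^ (sum of
-- parts).  Going from (t, 1 + d) to (1 + t, d) multiplies M by (1 + d)/(jk + d + 1) and adds u = jt/rk
-- to the exponent, which multiplies E by at most 1/(1 − u) = rk/(r (1 + d) + t): this is the truncated
-- form E (x + u) (1 − u) ≤ E x of e^(x+u) (1 − u) ≤ e^x, obtained by summing the termwise bounds
-- (x + u)^n/n! ≤ x^n/n! + u (x + u)^(n−1)/(n−1)!.  The two factors together are at most 1/r, because
-- r (1 + d) · rk ≤ (jk + d + 1) (r (1 + d) + t).

open import Defs

module Multinomial where

  open import Data.List using ([]; _∷_; length; map; _++_; [_])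
  open import Data.List.Properties using (map-++)
  open import Data.List.Relation.Unary.All using (universal)
  open import Data.List.Relation.Unary.All.Properties using (map⁺)
  open import Data.Nat using (zero; suc; _+_; _*_; _∸_; _^_; _!; _≤_; NonZero)
  open import Data.Nat.Combinatorics using (_C_; nCn≡1; nCk+nC[k+1]≡[n+1]C[k+1]; k![n∸k]!∣n!)
  open import Data.Nat.Combinatorics.Specification using (nCk≡n!/k![n-k]!)
  open import Data.Nat.DivMod using (_/_; m/n*n≡m)
  open import Data.Nat.ListAction using (sum; product)
  open import Data.Nat.ListAction.Properties using (sum-++; product-++; product≢0)
  open import Data.Nat.Properties
  open import Data.Nat.Tactic.RingSolver using (solve-∀)
  open import Relation.Binary.PropositionalEquality using (_≡_; refl; sym; trans; cong; subst; module ≡-Reasoning)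

  [m+n]Cm*m!*n!≡[m+n]! : ∀ m n → ((m + n) C m) * (m ! * n !) ≡ (m + n) !
  [m+n]Cm*m!*n!≡[m+n]! m n = begin
    ((m + n) C m) * (m ! * n !)                         ≡⟨ cong (λ k → ((m + n) C m) * (m ! * k !)) (m+n∸m≡n m n) ⟨
    ((m + n) C m) * (m ! * (m + n ∸ m) !)               ≡⟨ cong (_* (m ! * (m + n ∸ m) !)) (nCk≡n!/k![n-k]! (m≤m+n m n)) ⟩
    (m + n) ! / (m ! * (m + n ∸ m) !) * (m ! * (m + n ∸ m) !) ≡⟨ m/n*n≡m (k![n∸k]!∣n! (m≤m+n m n)) ⟩
    (m + n) !                                           ∎
    where
    open ≡-Reasoning
    instance _ = m !* (m + n ∸ m) !≢0

  multinomial*∏!≡sum! : ∀ as → multinomial as * product (map _! as) ≡ sum as !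
  multinomial*∏!≡sum! []       = refl
  multinomial*∏!≡sum! (a ∷ as) = begin
    ((a + s) C a) * multinomial as * (a ! * product (map _! as)) ≡⟨ reorder ((a + s) C a) (multinomial as) (a !) _ ⟩
    ((a + s) C a) * (a ! * (multinomial as * product (map _! as))) ≡⟨ cong (λ x → ((a + s) C a) * (a ! * x)) (multinomial*∏!≡sum! as) ⟩
    ((a + s) C a) * (a ! * s !)                                  ≡⟨ [m+n]Cm*m!*n!≡[m+n]! a s ⟩
    (a + s) !                                                    ∎
    where
    open ≡-Reasoning
    s = sum as
    reorder : ∀ c m x p → c * m * (x * p) ≡ c * (x * (m * p))
    reorder = solve-∀

  multinomial-snoc-suc : ∀ as d →
    multinomial (as ++ [ suc d ]) * suc d ≡ multinomial (as ++ [ d ]) * suc (sum as + d)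
  multinomial-snoc-suc as d = *-cancelʳ-≡ _ _ (p * d !) (begin
    multinomial (as ++ [ suc d ]) * suc d * (p * d !)   ≡⟨ reorder (multinomial (as ++ [ suc d ])) d p (d !) ⟩
    multinomial (as ++ [ suc d ]) * (p * suc d !)       ≡⟨ multinomial*∏!≡[sum+e]! (suc d) ⟩
    (sum as + suc d) !                                  ≡⟨ cong _! (+-suc (sum as) d) ⟩
    suc (sum as + d) * (sum as + d) !                   ≡⟨ cong (suc (sum as + d) *_) (multinomial*∏!≡[sum+e]! d) ⟨
    suc (sum as + d) * (multinomial (as ++ [ d ]) * (p * d !)) ≡⟨ reorder′ (suc (sum as + d)) (multinomial (as ++ [ d ])) (p * d !) ⟩
    multinomial (as ++ [ d ]) * suc (sum as + d) * (p * d !)   ∎)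
    where
    open ≡-Reasoning
    p = product (map _! as)
    instance
      p*d!≢0 : NonZero (p * d !)
      p*d!≢0 = m*n≢0 p (d !) {{product≢0 (map⁺ (universal _!≢0 as))}} {{d !≢0}}
    multinomial*∏!≡[sum+e]! : ∀ e → multinomial (as ++ [ e ]) * (p * e !) ≡ (sum as + e) !
    multinomial*∏!≡[sum+e]! e = begin
      multinomial (as ++ [ e ]) * (p * e !)                        ≡⟨ cong (λ f → multinomial (as ++ [ e ]) * (p * f)) (*-identityʳ (e !)) ⟨
      multinomial (as ++ [ e ]) * (p * product [ e ! ])            ≡⟨ cong (multinomial (as ++ [ e ]) *_) (product-++ (map _! as) [ e ! ]) ⟨
      multinomial (as ++ [ e ]) * product (map _! as ++ [ e ! ])   ≡⟨ cong (λ fs → multinomial (as ++ [ e ]) * product fs) (map-++ _! as [ e ]) ⟨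
      multinomial (as ++ [ e ]) * product (map _! (as ++ [ e ]))   ≡⟨ multinomial*∏!≡sum! (as ++ [ e ]) ⟩
      sum (as ++ [ e ]) !                                          ≡⟨ cong _! (trans (sum-++ as [ e ]) (cong (sum as +_) (+-identityʳ e))) ⟩
      (sum as + e) !                                               ∎
    reorder : ∀ m d p f → m * suc d * (p * f) ≡ m * (p * (f + d * f))
    reorder = solve-∀
    reorder′ : ∀ s m q → s * (m * q) ≡ m * s * q
    reorder′ = solve-∀

  [a+n]Ca*m^n≤[1+m]^[a+n] : ∀ m a n → ((a + n) C a) * m ^ n ≤ suc m ^ (a + n)
  [a+n]Ca*m^n≤[1+m]^[a+n] m zero    n       = ≤-trans (≤-reflexive (+-identityʳ (m ^ n))) (^-monoˡ-≤ n (n≤1+n m))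
  [a+n]Ca*m^n≤[1+m]^[a+n] m (suc a) zero    =
    subst (λ k → (k C suc a) * 1 ≤ suc m ^ k) (sym (+-identityʳ (suc a)))
          (≤-trans (≤-reflexive (trans (*-identityʳ _) (nCn≡1 (suc a)))) (m^n>0 (suc m) (suc a)))
  [a+n]Ca*m^n≤[1+m]^[a+n] m (suc a) (suc n) = begin
    ((suc a + suc n) C suc a) * m ^ suc n
      ≡⟨ cong (_* m ^ suc n) (nCk+nC[k+1]≡[n+1]C[k+1] (a + suc n) a) ⟨
    ((a + suc n) C a + (a + suc n) C suc a) * m ^ suc n
      ≡⟨ pascal-split ((a + suc n) C a) ((a + suc n) C suc a) m (m ^ n) ⟩
    ((a + suc n) C a) * m ^ suc n + m * (((a + suc n) C suc a) * m ^ n)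
      ≤⟨ +-mono-≤ ([a+n]Ca*m^n≤[1+m]^[a+n] m a (suc n)) (*-monoʳ-≤ m right) ⟩
    suc m ^ (a + suc n) + m * suc m ^ (a + suc n)
      ∎
    where
    open ≤-Reasoning
    pascal-split : ∀ x y m p → (x + y) * (m * p) ≡ x * (m * p) + m * (y * p)
    pascal-split = solve-∀
    right : ((a + suc n) C suc a) * m ^ n ≤ suc m ^ (a + suc n)
    right rewrite +-suc a n = [a+n]Ca*m^n≤[1+m]^[a+n] m (suc a) n

  multinomial≤length^sum : ∀ as → multinomial as ≤ length as ^ sum as
  multinomial≤length^sum []       = ≤-refl
  multinomial≤length^sum (a ∷ as) = begin
    ((a + sum as) C a) * multinomial as            ≤⟨ *-monoʳ-≤ ((a + sum as) C a) (multinomial≤length^sum as) ⟩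
    ((a + sum as) C a) * length as ^ sum as        ≤⟨ [a+n]Ca*m^n≤[1+m]^[a+n] (length as) a (sum as) ⟩
    suc (length as) ^ (a + sum as)                 ∎
    where open ≤-Reasoning


module NatToRational where

  open import Data.Integer as ℤ using (+_)
  import Data.Integer.Properties as ℤ
  open import Data.Nat as ℕ using (zero; suc; NonZero)
  open import Data.Nat.Coprimality using (1-coprimeTo) renaming (sym to coprime-sym)
  import Data.Nat.Properties as ℕ
  open import Data.Rational using (mkℚ; toℚᵘ; _+_; _*_; _-_; _≤_; 0ℚ; 1ℚ; NonNegative; Positive; *≤*; nonNegative)
  open import Data.Rational.Properties
  open import Data.Rational.Solver using (module +-*-Solver)
  import Data.Rational.Unnormalised as ℚᵘ
  import Data.Rational.Unnormalised.Properties as ℚᵘ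
  open import Relation.Binary.PropositionalEquality using (_≡_; refl; sym; trans; cong; cong₂; subst₂; module ≡-Reasoning)
  open +-*-Solver

  ℕtoℚ≡mkℚ : ∀ n → ℕtoℚ n ≡ mkℚ (+ n) 0 (coprime-sym (1-coprimeTo n))
  ℕtoℚ≡mkℚ n = normalize-coprime (coprime-sym (1-coprimeTo n))

  ℕtoℚ-+ : ∀ m n → ℕtoℚ (m ℕ.+ n) ≡ ℕtoℚ m + ℕtoℚ n
  ℕtoℚ-+ m n rewrite ℕtoℚ≡mkℚ m | ℕtoℚ≡mkℚ n =
    trans (ℕtoℚ≡mkℚ (m ℕ.+ n))
          (sym (trans (cong (Data.Rational._/ 1) (cong₂ ℤ._+_ (ℤ.*-identityʳ (+ m)) (ℤ.*-identityʳ (+ n))))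
                      (ℕtoℚ≡mkℚ (m ℕ.+ n))))

  ℕtoℚ-* : ∀ m n → ℕtoℚ (m ℕ.* n) ≡ ℕtoℚ m * ℕtoℚ n
  ℕtoℚ-* m n rewrite ℕtoℚ≡mkℚ m | ℕtoℚ≡mkℚ n =
    trans (ℕtoℚ≡mkℚ (m ℕ.* n))
          (sym (trans (cong (Data.Rational._/ 1) (sym (ℤ.pos-* m n))) (ℕtoℚ≡mkℚ (m ℕ.* n))))

  ℕtoℚ-*-interchange : ∀ a b c x → ℕtoℚ a * x * ℕtoℚ (b ℕ.* c) ≡ ℕtoℚ (a ℕ.* b) * (x * ℕtoℚ c)
  ℕtoℚ-*-interchange a b c x = begin
    ℕtoℚ a * x * ℕtoℚ (b ℕ.* c)         ≡⟨ cong (ℕtoℚ a * x *_) (ℕtoℚ-* b c) ⟩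
    ℕtoℚ a * x * (ℕtoℚ b * ℕtoℚ c)      ≡⟨ solve 4 (λ a x b c → a :* x :* (b :* c) := a :* b :* (x :* c)) refl (ℕtoℚ a) x (ℕtoℚ b) (ℕtoℚ c) ⟩
    ℕtoℚ a * ℕtoℚ b * (x * ℕtoℚ c)      ≡⟨ cong (_* (x * ℕtoℚ c)) (ℕtoℚ-* a b) ⟨
    ℕtoℚ (a ℕ.* b) * (x * ℕtoℚ c)       ∎
    where open ≡-Reasoning

  ℕtoℚ-mono-≤ : ∀ {m n} → m ℕ.≤ n → ℕtoℚ m ≤ ℕtoℚ n
  ℕtoℚ-mono-≤ {m} {n} m≤n rewrite ℕtoℚ≡mkℚ m | ℕtoℚ≡mkℚ n =
    *≤* (subst₂ ℤ._≤_ (sym (ℤ.*-identityʳ (+ m))) (sym (ℤ.*-identityʳ (+ n))) (ℤ.+≤+ m≤n))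

  ℕtoℚ-nonNeg : ∀ n → NonNegative (ℕtoℚ n)
  ℕtoℚ-nonNeg n = nonNegative (ℕtoℚ-mono-≤ (ℕ.z≤n {n}))

  ℕtoℚ-pos : ∀ n .{{_ : NonZero n}} → Positive (ℕtoℚ n)
  ℕtoℚ-pos (suc n) rewrite ℕtoℚ≡mkℚ (suc n) = _

  ℕtoℚ-*-cancelʳ : ∀ n .{{_ : NonZero n}} {x y} → x * ℕtoℚ n ≡ y * ℕtoℚ n → x ≡ y
  ℕtoℚ-*-cancelʳ n eq = ≤-antisym (*-cancelʳ-≤-pos (ℕtoℚ n) {{ℕtoℚ-pos n}} (≤-reflexive eq))
                                  (*-cancelʳ-≤-pos (ℕtoℚ n) {{ℕtoℚ-pos n}} (≤-reflexive (sym eq)))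

  ratio-nonNeg : ∀ a n → NonNegative (ratio a n)
  ratio-nonNeg a zero    = _
  ratio-nonNeg a (suc n) = normalize-nonNeg a (suc n)

  ratio-0 : ∀ n → ratio 0 n ≡ 0ℚ
  ratio-0 zero    = refl
  ratio-0 (suc n) = 0/n≡0 (suc n)

  ratio*ℕtoℚ : ∀ a n .{{_ : NonZero n}} → ratio a n * ℕtoℚ n ≡ ℕtoℚ a
  ratio*ℕtoℚ a (suc n) = toℚᵘ-injective (begin-equality
    toℚᵘ (ratio a (suc n) * ℕtoℚ (suc n))                    ≃⟨ toℚᵘ-homo-* (ratio a (suc n)) (ℕtoℚ (suc n)) ⟩
    toℚᵘ (ratio a (suc n)) ℚᵘ.* toℚᵘ (ℕtoℚ (suc n))          ≃⟨ ℚᵘ.*-cong (toℚᵘ-fromℚᵘ (ℚᵘ.mkℚᵘ (+ a) n)) (toℚᵘ-fromℚᵘ (ℚᵘ.mkℚᵘ (+ suc n) 0)) ⟩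
    ℚᵘ.mkℚᵘ (+ a) n ℚᵘ.* ℚᵘ.mkℚᵘ (+ suc n) 0                 ≃⟨ ℚᵘ.*≡* (trans (ℤ.*-identityʳ _) (cong (λ m → + a ℤ.* + m) (sym (ℕ.*-identityʳ (suc n))))) ⟩
    ℚᵘ.mkℚᵘ (+ a) 0                                          ≃⟨ toℚᵘ-fromℚᵘ (ℚᵘ.mkℚᵘ (+ a) 0) ⟨
    toℚᵘ (ℕtoℚ a)                                            ∎)
    where open ℚᵘ.≤-Reasoning

  ratio-+ : ∀ a b n .{{_ : NonZero n}} → ratio (a ℕ.+ b) n ≡ ratio a n + ratio b n
  ratio-+ a b n = ℕtoℚ-*-cancelʳ n (begin
    ratio (a ℕ.+ b) n * ℕtoℚ n                ≡⟨ ratio*ℕtoℚ (a ℕ.+ b) n ⟩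
    ℕtoℚ (a ℕ.+ b)                            ≡⟨ ℕtoℚ-+ a b ⟩
    ℕtoℚ a + ℕtoℚ b                           ≡⟨ cong₂ _+_ (ratio*ℕtoℚ a n) (ratio*ℕtoℚ b n) ⟨
    ratio a n * ℕtoℚ n + ratio b n * ℕtoℚ n   ≡⟨ *-distribʳ-+ (ℕtoℚ n) (ratio a n) (ratio b n) ⟨
    (ratio a n + ratio b n) * ℕtoℚ n          ∎)
    where open ≡-Reasoning

  m*ratio[a,m*n]≡ratio[a,n] : ∀ a m n .{{_ : NonZero m}} .{{_ : NonZero n}} →
                              ℕtoℚ m * ratio a (m ℕ.* n) ≡ ratio a n
  m*ratio[a,m*n]≡ratio[a,n] a m n = ℕtoℚ-*-cancelʳ n (begin
    ℕtoℚ m * ratio a (m ℕ.* n) * ℕtoℚ n      ≡⟨ solve 3 (λ m q n → m :* q :* n := q :* (m :* n)) refl (ℕtoℚ m) _ (ℕtoℚ n) ⟩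
    ratio a (m ℕ.* n) * (ℕtoℚ m * ℕtoℚ n)    ≡⟨ cong (ratio a (m ℕ.* n) *_) (ℕtoℚ-* m n) ⟨
    ratio a (m ℕ.* n) * ℕtoℚ (m ℕ.* n)       ≡⟨ ratio*ℕtoℚ a (m ℕ.* n) {{ℕ.m*n≢0 m n}} ⟩
    ℕtoℚ a                                   ≡⟨ ratio*ℕtoℚ a n ⟨
    ratio a n * ℕtoℚ n                       ∎)
    where open ≡-Reasoning

  ratio-mono-≤ : ∀ {a b m n} .{{_ : NonZero m}} .{{_ : NonZero n}} →
                 a ℕ.* n ℕ.≤ b ℕ.* m → ratio a m ≤ ratio b n
  ratio-mono-≤ {a} {b} {m} {n} an≤bm = *-cancelʳ-≤-pos (ℕtoℚ m * ℕtoℚ n) {{mn-pos}} (begin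
    ratio a m * (ℕtoℚ m * ℕtoℚ n)   ≡⟨ *-assoc (ratio a m) (ℕtoℚ m) (ℕtoℚ n) ⟨
    ratio a m * ℕtoℚ m * ℕtoℚ n     ≡⟨ cong (_* ℕtoℚ n) (ratio*ℕtoℚ a m) ⟩
    ℕtoℚ a * ℕtoℚ n                 ≡⟨ ℕtoℚ-* a n ⟨
    ℕtoℚ (a ℕ.* n)                  ≤⟨ ℕtoℚ-mono-≤ an≤bm ⟩
    ℕtoℚ (b ℕ.* m)                  ≡⟨ ℕtoℚ-* b m ⟩
    ℕtoℚ b * ℕtoℚ m                 ≡⟨ cong (_* ℕtoℚ m) (ratio*ℕtoℚ b n) ⟨
    ratio b n * ℕtoℚ n * ℕtoℚ m     ≡⟨ solve 3 (λ q n m → q :* n :* m := q :* (m :* n)) refl (ratio b n) (ℕtoℚ n) (ℕtoℚ m) ⟩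
    ratio b n * (ℕtoℚ m * ℕtoℚ n)   ∎)
    where
    open ≤-Reasoning
    mn-pos : Positive (ℕtoℚ m * ℕtoℚ n)
    mn-pos = pos*pos⇒pos (ℕtoℚ m) {{ℕtoℚ-pos m}} (ℕtoℚ n) {{ℕtoℚ-pos n}}

  [1-ratio[a,b]]*b≡c : ∀ a b c .{{_ : NonZero b}} → a ℕ.+ c ≡ b → (1ℚ - ratio a b) * ℕtoℚ b ≡ ℕtoℚ c
  [1-ratio[a,b]]*b≡c a b c refl = begin
    (1ℚ - ratio a b) * ℕtoℚ b                 ≡⟨ solve 2 (λ q x → (con 1ℚ :- q) :* x := x :- q :* x) refl (ratio a b) (ℕtoℚ b) ⟩
    ℕtoℚ b - ratio a b * ℕtoℚ b               ≡⟨ cong₂ _-_ (ℕtoℚ-+ a c) (ratio*ℕtoℚ a b) ⟩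
    ℕtoℚ a + ℕtoℚ c - ℕtoℚ a                  ≡⟨ solve 2 (λ x y → x :+ y :- x := y) refl (ℕtoℚ a) (ℕtoℚ c) ⟩
    ℕtoℚ c                                    ∎
    where open ≡-Reasoning


module PartialExponential where

  open import Data.Nat as ℕ using (ℕ; zero; suc; _!; NonZero)
  import Data.Nat.Properties as ℕ
  open import Data.Rational using (ℚ; _+_; _*_; -_; _-_; _≤_; 0ℚ; 1ℚ; NonNegative; nonNegative)
  open import Data.Rational.Properties
  open import Data.Rational.Solver using (module +-*-Solver)
  open import Relation.Binary.PropositionalEquality using (_≡_; refl; trans; cong; cong₂; module ≡-Reasoning)
  open +-*-Solver
  open NatToRational

  ^ℚ-nonNeg : ∀ n x .{{_ : NonNegative x}} → NonNegative (x ^ℚ n)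
  ^ℚ-nonNeg zero    x = _
  ^ℚ-nonNeg (suc n) x = nonNeg*nonNeg⇒nonNeg x (x ^ℚ n) {{^ℚ-nonNeg n x}}

  ^ℚ-mono-≤ : ∀ n {x y} .{{_ : NonNegative x}} → x ≤ y → x ^ℚ n ≤ y ^ℚ n
  ^ℚ-mono-≤ zero    x≤y = ≤-refl
  ^ℚ-mono-≤ (suc n) {x} {y} x≤y = begin
    x * x ^ℚ n   ≤⟨ *-monoˡ-≤-nonNeg x (^ℚ-mono-≤ n x≤y) ⟩
    x * y ^ℚ n   ≤⟨ *-monoʳ-≤-nonNeg (y ^ℚ n) {{^ℚ-nonNeg n y}} x≤y ⟩
    y * y ^ℚ n   ∎
    where
    open ≤-Reasoning
    instance
      y-nonNeg : NonNegative y
      y-nonNeg = nonNegative (≤-trans (nonNegative⁻¹ x) x≤y)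

  x≤x+u : ∀ x u .{{_ : NonNegative u}} → x ≤ x + u
  x≤x+u x u = begin
    x        ≡⟨ +-identityʳ x ⟨
    x + 0ℚ   ≤⟨ +-monoʳ-≤ x (nonNegative⁻¹ u) ⟩
    x + u    ∎
    where open ≤-Reasoning

  [x+u]^[1+n]≤x^[1+n]+[1+n]*u*[x+u]^n : ∀ n x u .{{_ : NonNegative x}} .{{_ : NonNegative u}} →
    (x + u) ^ℚ suc n ≤ x ^ℚ suc n + ℕtoℚ (suc n) * u * (x + u) ^ℚ n
  [x+u]^[1+n]≤x^[1+n]+[1+n]*u*[x+u]^n zero    x u =
    ≤-reflexive (solve 2 (λ x u → (x :+ u) :* con 1ℚ := x :* con 1ℚ :+ con 1ℚ :* u :* con 1ℚ) refl x u)
  [x+u]^[1+n]≤x^[1+n]+[1+n]*u*[x+u]^n (suc n) x u = begin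
    (x + u) * (x + u) ^ℚ suc n
      ≤⟨ *-monoˡ-≤-nonNeg (x + u) {{x+u-nonNeg}} ([x+u]^[1+n]≤x^[1+n]+[1+n]*u*[x+u]^n n x u) ⟩
    (x + u) * (x ^ℚ suc n + k * u * (x + u) ^ℚ n)
      ≡⟨ solve 5 (λ x u p k q → (x :+ u) :* (p :+ k :* u :* q) := x :* p :+ u :* p :+ k :* u :* ((x :+ u) :* q))
               refl x u (x ^ℚ suc n) k ((x + u) ^ℚ n) ⟩
    x * x ^ℚ suc n + u * x ^ℚ suc n + k * u * (x + u) ^ℚ suc n
      ≤⟨ +-monoˡ-≤ (k * u * (x + u) ^ℚ suc n) (+-monoʳ-≤ (x * x ^ℚ suc n)
           (*-monoˡ-≤-nonNeg u (^ℚ-mono-≤ (suc n) (x≤x+u x u)))) ⟩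
    x * x ^ℚ suc n + u * (x + u) ^ℚ suc n + k * u * (x + u) ^ℚ suc n
      ≡⟨ solve 4 (λ p u c k → p :+ u :* c :+ k :* u :* c := p :+ (con 1ℚ :+ k) :* u :* c)
               refl (x * x ^ℚ suc n) u ((x + u) ^ℚ suc n) k ⟩
    x ^ℚ suc (suc n) + (1ℚ + k) * u * (x + u) ^ℚ suc n
      ≡⟨ cong (λ k′ → x ^ℚ suc (suc n) + k′ * u * (x + u) ^ℚ suc n) (ℕtoℚ-+ 1 (suc n)) ⟨
    x ^ℚ suc (suc n) + ℕtoℚ (suc (suc n)) * u * (x + u) ^ℚ suc n
      ∎
    where
    open ≤-Reasoning
    k = ℕtoℚ (suc n)
    x+u-nonNeg : NonNegative (x + u)
    x+u-nonNeg = nonNeg+nonNeg⇒nonNeg x u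

  term : ℕ → ℚ → ℚ
  term n x = x ^ℚ n * ratio 1 (n !)

  term-nonNeg : ∀ n x .{{_ : NonNegative x}} → NonNegative (term n x)
  term-nonNeg n x = nonNeg*nonNeg⇒nonNeg (x ^ℚ n) {{^ℚ-nonNeg n x}} (ratio 1 (n !)) {{ratio-nonNeg 1 (n !)}}

  term-suc-+-≤ : ∀ n x u .{{_ : NonNegative x}} .{{_ : NonNegative u}} →
                 term (suc n) (x + u) ≤ term (suc n) x + u * term n (x + u)
  term-suc-+-≤ n x u = begin
    (x + u) ^ℚ suc n * c
      ≤⟨ *-monoʳ-≤-nonNeg c {{ratio-nonNeg 1 (suc n !)}} ([x+u]^[1+n]≤x^[1+n]+[1+n]*u*[x+u]^n n x u) ⟩
    (x ^ℚ suc n + ℕtoℚ (suc n) * u * (x + u) ^ℚ n) * c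
      ≡⟨ solve 5 (λ p k u q c → (p :+ k :* u :* q) :* c := p :* c :+ u :* (q :* (k :* c)))
               refl (x ^ℚ suc n) (ℕtoℚ (suc n)) u ((x + u) ^ℚ n) c ⟩
    x ^ℚ suc n * c + u * ((x + u) ^ℚ n * (ℕtoℚ (suc n) * c))
      ≡⟨ cong (λ c′ → x ^ℚ suc n * c + u * ((x + u) ^ℚ n * c′)) (m*ratio[a,m*n]≡ratio[a,n] 1 (suc n) (n !) {{_}} {{ℕ._!≢0 n}}) ⟩
    x ^ℚ suc n * c + u * ((x + u) ^ℚ n * ratio 1 (n !))
      ∎
    where
    open ≤-Reasoning
    c = ratio 1 (suc n !)

  expPartial-nonNeg : ∀ N x .{{_ : NonNegative x}} → NonNegative (expPartial N x)
  expPartial-nonNeg zero    x = _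
  expPartial-nonNeg (suc N) x =
    nonNeg+nonNeg⇒nonNeg (expPartial N x) {{expPartial-nonNeg N x}} (term (suc N) x) {{term-nonNeg (suc N) x}}

  expPartial-mono-≤ : ∀ N {x y} .{{_ : NonNegative x}} → x ≤ y → expPartial N x ≤ expPartial N y
  expPartial-mono-≤ zero    x≤y = ≤-refl
  expPartial-mono-≤ (suc N) x≤y =
    +-mono-≤ (expPartial-mono-≤ N x≤y) (*-monoʳ-≤-nonNeg _ {{ratio-nonNeg 1 (suc N !)}} (^ℚ-mono-≤ (suc N) x≤y))

  expPartial-0 : ∀ N → expPartial N 0ℚ ≡ 1ℚ
  expPartial-0 zero    = refl
  expPartial-0 (suc N) = begin
    expPartial N 0ℚ + 0ℚ * 0ℚ ^ℚ N * ratio 1 (suc N !)  ≡⟨ cong₂ _+_ (expPartial-0 N) (trans (cong (_* ratio 1 (suc N !)) (*-zeroˡ (0ℚ ^ℚ N))) (*-zeroˡ (ratio 1 (suc N !)))) ⟩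
    1ℚ + 0ℚ                                             ≡⟨⟩
    1ℚ                                                  ∎
    where open ≡-Reasoning

  expPartial-suc-+-≤ : ∀ N x u .{{_ : NonNegative x}} .{{_ : NonNegative u}} →
    expPartial (suc N) (x + u) ≤ expPartial (suc N) x + u * expPartial N (x + u)
  expPartial-suc-+-≤ zero    x u = begin
    1ℚ + term 1 (x + u)                 ≤⟨ +-monoʳ-≤ 1ℚ (term-suc-+-≤ 0 x u) ⟩
    1ℚ + (term 1 x + u * term 0 (x + u)) ≡⟨ +-assoc 1ℚ (term 1 x) (u * 1ℚ) ⟨
    1ℚ + term 1 x + u * 1ℚ               ∎
    where open ≤-Reasoning
  expPartial-suc-+-≤ (suc N) x u = begin
    expPartial (suc N) (x + u) + term (suc (suc N)) (x + u)
      ≤⟨ +-mono-≤ (expPartial-suc-+-≤ N x u) (term-suc-+-≤ (suc N) x u) ⟩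
    (expPartial (suc N) x + u * expPartial N (x + u)) + (term (suc (suc N)) x + u * term (suc N) (x + u))
      ≡⟨ solve 5 (λ a u b c d → (a :+ u :* b) :+ (c :+ u :* d) := (a :+ c) :+ u :* (b :+ d))
               refl (expPartial (suc N) x) u (expPartial N (x + u)) (term (suc (suc N)) x) (term (suc N) (x + u)) ⟩
    expPartial (suc (suc N)) x + u * expPartial (suc N) (x + u)
      ∎
    where open ≤-Reasoning

  expPartial[x+u]*[1-u]≤expPartial[x] : ∀ N x u .{{_ : NonNegative x}} .{{_ : NonNegative u}} →
    expPartial N (x + u) * (1ℚ - u) ≤ expPartial N x
  expPartial[x+u]*[1-u]≤expPartial[x] zero    x u = begin
    1ℚ * (1ℚ - u)   ≡⟨ *-identityˡ (1ℚ - u) ⟩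
    1ℚ - u          ≤⟨ +-monoʳ-≤ 1ℚ (neg-antimono-≤ (nonNegative⁻¹ u)) ⟩
    1ℚ - 0ℚ         ≡⟨⟩
    1ℚ              ∎
    where open ≤-Reasoning
  expPartial[x+u]*[1-u]≤expPartial[x] (suc N) x u = begin
    e′ * (1ℚ - u)                         ≡⟨ solve 2 (λ e u → e :* (con 1ℚ :- u) := e :- u :* e) refl e′ u ⟩
    e′ - u * e′                           ≤⟨ +-monoˡ-≤ (- (u * e′)) (expPartial-suc-+-≤ N x u) ⟩
    e + u * expPartial N (x + u) - u * e′ ≤⟨ +-monoˡ-≤ (- (u * e′)) (+-monoʳ-≤ e (*-monoˡ-≤-nonNeg u expPartial[N]≤e′)) ⟩
    e + u * e′ - u * e′                   ≡⟨ solve 2 (λ e f → e :+ f :- f := e) refl e (u * e′) ⟩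
    e                                     ∎
    where
    open ≤-Reasoning
    e′ = expPartial (suc N) (x + u)
    e  = expPartial (suc N) x
    instance
      x+u-nonNeg : NonNegative (x + u)
      x+u-nonNeg = nonNeg+nonNeg⇒nonNeg x u
    expPartial[N]≤e′ : expPartial N (x + u) ≤ e′
    expPartial[N]≤e′ = x≤x+u (expPartial N (x + u)) (term (suc N) (x + u)) {{term-nonNeg (suc N) (x + u)}}

  expPartial[x+a/b]*c≤expPartial[x]*b : ∀ N x a b c .{{_ : NonNegative x}} .{{_ : NonZero b}} →
    a ℕ.+ c ≡ b → expPartial N (x + ratio a b) * ℕtoℚ c ≤ expPartial N x * ℕtoℚ b
  expPartial[x+a/b]*c≤expPartial[x]*b N x a b c a+c≡b = begin
    expPartial N (x + u) * ℕtoℚ c                ≡⟨ cong (expPartial N (x + u) *_) ([1-ratio[a,b]]*b≡c a b c a+c≡b) ⟨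
    expPartial N (x + u) * ((1ℚ - u) * ℕtoℚ b)   ≡⟨ *-assoc (expPartial N (x + u)) (1ℚ - u) (ℕtoℚ b) ⟨
    expPartial N (x + u) * (1ℚ - u) * ℕtoℚ b     ≤⟨ *-monoʳ-≤-nonNeg (ℕtoℚ b) {{ℕtoℚ-nonNeg b}}
                                                      (expPartial[x+u]*[1-u]≤expPartial[x] N x u) ⟩
    expPartial N x * ℕtoℚ b                      ∎
    where
    open ≤-Reasoning
    u = ratio a b
    instance
      u-nonNeg : NonNegative u
      u-nonNeg = ratio-nonNeg a b


open import Data.List using (replicate; _++_; [_])
open import Data.List.Properties using (length-++; length-replicate)
open import Data.Nat using (ℕ; zero; suc; _+_; _*_; _∸_; _^_; _≤_; z≤n; s≤s; NonZero; >-nonZero)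
open import Data.Nat.ListAction using (sum)
open import Data.Nat.ListAction.Properties using (sum-++)
open import Data.Nat.Properties
open import Data.Nat.Tactic.RingSolver using (solve-∀)
open import Data.Rational as ℚ using (ℚ)
import Data.Rational.Properties as ℚ
open import Relation.Binary.PropositionalEquality using (_≡_; refl; sym; trans; cong; cong₂; subst; subst₂; module ≡-Reasoning)
open Multinomial
open NatToRational
open PartialExponential

triangle : ℕ → ℕ
triangle zero    = 0
triangle (suc n) = triangle n + n

2*triangle+n≡n*n : ∀ n → 2 * triangle n + n ≡ n * n
2*triangle+n≡n*n zero    = refl
2*triangle+n≡n*n (suc n) = begin
  2 * (triangle n + n) + suc n       ≡⟨ regroup (triangle n) n ⟩
  2 * triangle n + n + (n + suc n)   ≡⟨ cong (_+ (n + suc n)) (2*triangle+n≡n*n n) ⟩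
  n * n + (n + suc n)                ≡⟨ square-suc n ⟩
  suc n * suc n                      ∎
  where
  open ≡-Reasoning
  regroup : ∀ t n → 2 * (t + n) + suc n ≡ 2 * t + n + (n + suc n)
  regroup = solve-∀
  square-suc : ∀ n → n * n + (n + suc n) ≡ suc n * suc n
  square-suc = solve-∀

n≤triangle : ∀ n → 3 ≤ n → n ≤ triangle n
n≤triangle 0 ()
n≤triangle 1 (s≤s ())
n≤triangle 2 (s≤s (s≤s ()))
n≤triangle 3 _ = ≤-refl
n≤triangle (suc n@(suc (suc (suc _)))) _ = begin
  suc n             ≡⟨ +-comm 1 n ⟩
  n + 1             ≤⟨ +-mono-≤ (n≤triangle n (s≤s (s≤s (s≤s z≤n)))) (s≤s z≤n) ⟩
  triangle n + n    ∎
  where open ≤-Reasoning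

n*n≤3*triangle : ∀ n → 3 ≤ n → n * n ≤ 3 * triangle n
n*n≤3*triangle n 3≤n = begin
  n * n                          ≡⟨ 2*triangle+n≡n*n n ⟨
  2 * triangle n + n             ≤⟨ +-monoʳ-≤ (2 * triangle n) (n≤triangle n 3≤n) ⟩
  2 * triangle n + triangle n    ≡⟨ +-comm (2 * triangle n) (triangle n) ⟩
  3 * triangle n                 ∎
  where open ≤-Reasoning

sum-replicate : ∀ n m → sum (replicate n m) ≡ n * m
sum-replicate zero    m = refl
sum-replicate (suc n) m = cong (m +_) (sum-replicate n m)

multinomial-blocks-suc : ∀ j k d → multinomial (replicate j k ++ [ suc d ]) * suc d
                                   ≡ multinomial (replicate j k ++ [ d ]) * suc (j * k + d)
multinomial-blocks-suc j k d =
  subst (λ s → multinomial (replicate j k ++ [ suc d ]) * suc d ≡ multinomial (replicate j k ++ [ d ]) * suc (s + d))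
        (sum-replicate j k) (multinomial-snoc-suc (replicate j k) d)

multinomial-blocks≤ : ∀ j k d → multinomial (replicate j k ++ [ d ]) ≤ suc j ^ (j * k + d)
multinomial-blocks≤ j k d = subst₂ (λ m s → multinomial (replicate j k ++ [ d ]) ≤ m ^ s)
  (trans (length-++ (replicate j k)) (trans (cong (_+ 1) (length-replicate j)) (+-comm j 1)))
  (trans (sum-++ (replicate j k) [ d ]) (cong₂ _+_ (sum-replicate j k) (+-identityʳ d)))
  (multinomial≤length^sum (replicate j k ++ [ d ]))

-- With r = 1 + j, k = 1 + t + d and c = r (1 + d) + t:

jt+c≡rk : ∀ j t d → j * t + (suc j * suc d + t) ≡ suc j * suc (t + d)
jt+c≡rk = solve-∀

r*[1+d]*rk≤[jk+d+1]*c : ∀ j t d →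
  suc j * (suc d * (suc j * suc (t + d))) ≤ suc (j * suc (t + d) + d) * (suc j * suc d + t)
r*[1+d]*rk≤[jk+d+1]*c j t d = ≤-trans (m≤m+n _ (j * t * t)) (≤-reflexive (identity j t d))
  where
  identity : ∀ j t d → suc j * (suc d * (suc j * suc (t + d))) + j * t * t
                       ≡ suc (j * suc (t + d) + d) * (suc j * suc d + t)
  identity = solve-∀

multinomial-blocks*expPartial≤ : ∀ N j k t d → t + d ≡ k →
  ℕtoℚ (multinomial (replicate j k ++ [ d ])) ℚ.* expPartial N (ratio (j * triangle t) (suc j * k))
    ℚ.≤ ℕtoℚ (suc j ^ (j * k + d))
multinomial-blocks*expPartial≤ N j k zero d refl = begin
  ℕtoℚ m ℚ.* expPartial N (ratio (j * 0) (suc j * d))  ≡⟨ cong (λ a → ℕtoℚ m ℚ.* expPartial N (ratio a (suc j * d))) (*-zeroʳ j) ⟩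
  ℕtoℚ m ℚ.* expPartial N (ratio 0 (suc j * d))        ≡⟨ cong (λ x → ℕtoℚ m ℚ.* expPartial N x) (ratio-0 (suc j * d)) ⟩
  ℕtoℚ m ℚ.* expPartial N ℚ.0ℚ                         ≡⟨ cong (ℕtoℚ m ℚ.*_) (expPartial-0 N) ⟩
  ℕtoℚ m ℚ.* ℚ.1ℚ                                      ≡⟨ ℚ.*-identityʳ (ℕtoℚ m) ⟩
  ℕtoℚ m                                               ≤⟨ ℕtoℚ-mono-≤ (multinomial-blocks≤ j d d) ⟩
  ℕtoℚ (suc j ^ (j * d + d))                           ∎
  where
  open ℚ.≤-Reasoning
  m = multinomial (replicate j d ++ [ d ])
multinomial-blocks*expPartial≤ N j k (suc t) d refl = ℚ.*-cancelʳ-≤-pos (ℕtoℚ (D * c)) {{ℕtoℚ-pos (D * c)}} (begin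
  ℕtoℚ (m d) ℚ.* expPartial N (ratio (j * triangle (suc t)) rk) ℚ.* ℕtoℚ (D * c)
    ≡⟨ cong (λ y → ℕtoℚ (m d) ℚ.* expPartial N y ℚ.* ℕtoℚ (D * c)) exponent-suc ⟩
  ℕtoℚ (m d) ℚ.* expPartial N (x ℚ.+ ratio (j * t) rk) ℚ.* ℕtoℚ (D * c)
    ≡⟨ ℕtoℚ-*-interchange (m d) D c _ ⟩
  ℕtoℚ (m d * D) ℚ.* (expPartial N (x ℚ.+ ratio (j * t) rk) ℚ.* ℕtoℚ c)
    ≤⟨ ℚ.*-monoˡ-≤-nonNeg (ℕtoℚ (m d * D)) {{ℕtoℚ-nonNeg (m d * D)}}
         (expPartial[x+a/b]*c≤expPartial[x]*b N x (j * t) rk c {{ratio-nonNeg (j * triangle t) rk}} (jt+c≡rk j t d)) ⟩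
  ℕtoℚ (m d * D) ℚ.* (expPartial N x ℚ.* ℕtoℚ rk)
    ≡⟨ cong (λ a → ℕtoℚ a ℚ.* (expPartial N x ℚ.* ℕtoℚ rk)) (multinomial-blocks-suc j k d) ⟨
  ℕtoℚ (m (suc d) * suc d) ℚ.* (expPartial N x ℚ.* ℕtoℚ rk)
    ≡⟨ ℕtoℚ-*-interchange (m (suc d)) (suc d) rk (expPartial N x) ⟨
  ℕtoℚ (m (suc d)) ℚ.* expPartial N x ℚ.* ℕtoℚ (suc d * rk)
    ≤⟨ ℚ.*-monoʳ-≤-nonNeg (ℕtoℚ (suc d * rk)) {{ℕtoℚ-nonNeg (suc d * rk)}}
         (multinomial-blocks*expPartial≤ N j k t (suc d) (+-suc t d)) ⟩
  ℕtoℚ (r ^ (j * k + suc d)) ℚ.* ℕtoℚ (suc d * rk)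
    ≡⟨ ℕtoℚ-* (r ^ (j * k + suc d)) (suc d * rk) ⟨
  ℕtoℚ (r ^ (j * k + suc d) * (suc d * rk))
    ≡⟨ cong ℕtoℚ power-regroup ⟩
  ℕtoℚ (r ^ n * (r * (suc d * rk)))
    ≤⟨ ℕtoℚ-mono-≤ (*-monoʳ-≤ (r ^ n) (r*[1+d]*rk≤[jk+d+1]*c j t d)) ⟩
  ℕtoℚ (r ^ n * (D * c))
    ≡⟨ ℕtoℚ-* (r ^ n) (D * c) ⟩
  ℕtoℚ (r ^ n) ℚ.* ℕtoℚ (D * c)
    ∎)
  where
  open ℚ.≤-Reasoning
  r = suc j
  rk = r * k
  n = j * k + d
  D = suc n
  c = r * suc d + t
  m : ℕ → ℕ
  m d = multinomial (replicate j k ++ [ d ])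
  x = ratio (j * triangle t) rk
  exponent-suc : ratio (j * triangle (suc t)) rk ≡ x ℚ.+ ratio (j * t) rk
  exponent-suc = trans (cong (λ a → ratio a rk) (*-distribˡ-+ j (triangle t) t)) (ratio-+ (j * triangle t) (j * t) rk)
  power-regroup : r ^ (j * k + suc d) * (suc d * rk) ≡ r ^ n * (r * (suc d * rk))
  power-regroup = trans (cong (λ p → r ^ p * (suc d * rk)) (+-suc (j * k) d))
                        (trans (cong (_* (suc d * rk)) (*-comm r (r ^ n))) (*-assoc (r ^ n) r (suc d * rk)))

lemmaA1 : (k t r : ℕ) → 3 ≤ t → t ≤ k → 1 ≤ r → (N : ℕ) →
    ℕtoℚ (multinomial (replicate (r ∸ 1) k ++ [ k ∸ t ]))
      ℚ.* expPartial N (ratio ((r ∸ 1) * (t * t)) (3 * r * k))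
      ℚ.≤ ℕtoℚ (r ^ (r * k ∸ t))
lemmaA1 k t (suc j) 3≤t t≤k (s≤s z≤n) N = begin
  ℕtoℚ m ℚ.* expPartial N (ratio (j * (t * t)) (3 * suc j * k))
    ≤⟨ ℚ.*-monoˡ-≤-nonNeg (ℕtoℚ m) {{ℕtoℚ-nonNeg m}}
         (expPartial-mono-≤ N {{ratio-nonNeg (j * (t * t)) (3 * suc j * k)}} (ratio-mono-≤ exponent-≤)) ⟩
  ℕtoℚ m ℚ.* expPartial N (ratio (j * triangle t) (suc j * k))
    ≤⟨ multinomial-blocks*expPartial≤ N j k t (k ∸ t) (m+[n∸m]≡n t≤k) ⟩
  ℕtoℚ (suc j ^ (j * k + (k ∸ t)))
    ≡⟨ cong (λ e → ℕtoℚ (suc j ^ e)) (trans (+-comm (j * k) (k ∸ t)) (sym (+-∸-comm (j * k) t≤k))) ⟩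
  ℕtoℚ (suc j ^ (suc j * k ∸ t))
    ∎
  where
  open ℚ.≤-Reasoning
  m = multinomial (replicate j k ++ [ k ∸ t ])
  instance
    k≢0 : NonZero k
    k≢0 = >-nonZero (≤-trans (s≤s z≤n) (≤-trans 3≤t t≤k))
    rk≢0 : NonZero (suc j * k)
    rk≢0 = m*n≢0 (suc j) k
    3rk≢0 : NonZero (3 * suc j * k)
    3rk≢0 = m*n≢0 (3 * suc j) k
  exponent-≤ : j * (t * t) * (suc j * k) ≤ j * triangle t * (3 * suc j * k)
  exponent-≤ = ≤-trans (*-monoˡ-≤ (suc j * k) (*-monoʳ-≤ j (n*n≤3*triangle t 3≤t))) (≤-reflexive (regroup j (triangle t) (suc j) k))
    where
    regroup : ∀ j s r k → j * (3 * s) * (r * k) ≡ j * s * (3 * r * k)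
    regroup = solve-∀
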